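{- For a propositional variable $p$, the formula $[\neg\bullet p]\neg\bullet p$ is provable in $\mathbf{K}^{\bullet[\cdot]}$.
   Context: Fix a nonempty set $\mathbf{P}$ of propositional variables. Formulas: $\varphi::=p\mid\neg\varphi\mid\varphi\land\varphi\mid\bullet\varphi\mid[\varphi]\varphi$ ($p\in\mathbf{P}$), with $\circ\varphi:=\neg\bullet\varphi$. The system $\mathbf{K}^{\bullet[\cdot]}$ has axioms: A0 all propositional tautologies; A1 $\bullet\varphi\to\varphi$; A3 $\bullet(\psi\to\varphi)\land\varphi\to\bullet\varphi$; A5 $\bullet(\varphi\land\psi)\to\bullet\varphi\vee\bullet\psi$; AP $[\psi]p\leftrightarrow(\psi\to p)$; AN $[\psi]\neg\varphi\leftrightarrow(\psi\to\neg[\psi]\varphi)$; AC $[\psi](\varphi\land\chi)\leftrightarrow([\psi]\varphi\land[\psi]\chi)$; AA $[\psi][\chi]\varphi\leftrightarrow[\psi\land[\psi]\chi]\varphi$; A$\bullet$ $[\psi]\bullet\varphi\leftrightarrow(\psi\to\bullet[\psi]\varphi)$; and rules: from $\varphi$ infer $\circ\varphi$; from $\varphi\leftrightarrow\psi$ infer $\circ\varphi\leftrightarrow\circ\psi$; modus ponens. -}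

module Defs where

open import Data.Bool using (Bool; true; false; not; _∧_)
open import Relation.Binary.PropositionalEquality using (_≡_)

data Form (P : Set) : Set where
  var  : P → Form P
  ¬'_  : Form P → Form P
  _∧'_ : Form P → Form P → Form P
  ●_   : Form P → Form P
  [_]_ : Form P → Form P → Form P

infixr 9 ¬'_ ●_ [_]_
infixr 8 _∧'_

module _ {P : Set} where
  infixr 9 ○_
  infixr 7 _∨'_
  infixr 6 _→'_
  infix  5 _↔'_
  ○_ : Form P → Form P
  ○ φ = ¬' ● φ

  _∨'_ : Form P → Form P → Form P
  φ ∨' ψ = ¬' (¬' φ ∧' ¬' ψ)

  _→'_ : Form P → Form P → Form P
  φ →' ψ = ¬' (φ ∧' ¬' ψ)

  _↔'_ : Form P → Form P → Form P
  φ ↔' ψ = (φ →' ψ) ∧' (ψ →' φ)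

  eval : (Form P → Bool) → Form P → Bool
  eval v (var p)   = v (var p)
  eval v (¬' φ)    = not (eval v φ)
  eval v (φ ∧' ψ)  = eval v φ ∧ eval v ψ
  eval v (● φ)     = v (● φ)
  eval v ([ ψ ] φ) = v ([ ψ ] φ)

  -- φ is an instance of a propositional tautology
  Tautology : Form P → Set
  Tautology φ = ∀ (v : Form P → Bool) → eval v φ ≡ true

  data ⊢_ : Form P → Set where
    A0  : ∀ {φ} → Tautology φ → ⊢ φ
    A1  : ∀ φ → ⊢ (● φ →' φ)
    A3  : ∀ φ ψ → ⊢ ((● (ψ →' φ) ∧' φ) →' ● φ)
    A5  : ∀ φ ψ → ⊢ (● (φ ∧' ψ) →' (● φ ∨' ● ψ))
    AP  : ∀ ψ p → ⊢ ([ ψ ] var p ↔' (ψ →' var p))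
    AN  : ∀ ψ φ → ⊢ ([ ψ ] ¬' φ ↔' (ψ →' ¬' [ ψ ] φ))
    AC  : ∀ ψ φ χ → ⊢ ([ ψ ] (φ ∧' χ) ↔' ([ ψ ] φ ∧' [ ψ ] χ))
    AA  : ∀ ψ χ φ → ⊢ ([ ψ ] [ χ ] φ ↔' [ ψ ∧' [ ψ ] χ ] φ)
    A●  : ∀ ψ φ → ⊢ ([ ψ ] ● φ ↔' (ψ →' ● [ ψ ] φ))
    NecO : ∀ {φ} → ⊢ φ → ⊢ (○ φ)
    REO  : ∀ {φ ψ} → ⊢ (φ ↔' ψ) → ⊢ (○ φ ↔' ○ ψ)
    MP   : ∀ {φ ψ} → ⊢ (φ →' ψ) → ⊢ φ → ⊢ ψ

  infix 4 ⊢_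

-- Write ψ = ○ p.  Axioms A1 and A3 together give ●(ψ → p) ∧ ψ → ● p, and since ψ
-- says ¬ ● p this yields ψ → ○(ψ → p).  Pushing the announcement inwards with AP
-- (under ○, by REO), A● and AN turns this into [ψ] ○ p.
module Submission where

open import Defs
open import Data.Bool using (true; false)
open import Relation.Binary.PropositionalEquality using (refl)

module _ {P : Set} where

  ⊢-taut₂ : ∀ {φ ψ χ : Form P} → Tautology (φ →' ψ →' χ) → ⊢ φ → ⊢ ψ → ⊢ χ
  ⊢-taut₂ t h₁ h₂ = MP (MP (A0 t) h₁) h₂

  ⊢-↔-elimʳ : ∀ {φ ψ : Form P} → ⊢ (φ ↔' ψ) → ⊢ ψ → ⊢ φ
  ⊢-↔-elimʳ {φ} {ψ} = ⊢-taut₂ taut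
    where
    taut : Tautology ((φ ↔' ψ) →' ψ →' φ)
    taut v with eval v φ | eval v ψ
    ... | true  | true  = refl
    ... | true  | false = refl
    ... | false | true  = refl
    ... | false | false = refl

  ⊢-→-↔-substʳ : ∀ {φ χ ψ : Form P} → ⊢ (χ ↔' φ) → ⊢ (ψ →' φ) → ⊢ (ψ →' χ)
  ⊢-→-↔-substʳ {φ} {χ} {ψ} = ⊢-taut₂ taut
    where
    taut : Tautology ((χ ↔' φ) →' (ψ →' φ) →' (ψ →' χ))
    taut v with eval v χ | eval v φ | eval v ψ
    ... | true  | true  | true  = refl
    ... | true  | true  | false = refl
    ... | true  | false | true  = refl
    ... | true  | false | false = refl
    ... | false | true  | true  = refl
    ... | false | true  | false = refl
    ... | false | false | true  = refl
    ... | false | false | false = refl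

  ●-mp : ∀ (ψ φ : Form P) → ⊢ (● (ψ →' φ) ∧' ψ →' ● φ)
  ●-mp ψ φ = ⊢-taut₂ taut (A1 (ψ →' φ)) (A3 φ ψ)
    where
    taut : Tautology ((● (ψ →' φ) →' ψ →' φ) →' (● (ψ →' φ) ∧' φ →' ● φ)
                        →' (● (ψ →' φ) ∧' ψ →' ● φ))
    taut v with v (● (ψ →' φ)) | eval v ψ | eval v φ | v (● φ)
    ... | false | _     | _     | _     = refl
    ... | true  | false | false | false = refl
    ... | true  | false | false | true  = refl
    ... | true  | false | true  | false = refl
    ... | true  | false | true  | true  = refl
    ... | true  | true  | false | false = refl
    ... | true  | true  | false | true  = refl
    ... | true  | true  | true  | false = refl
    ... | true  | true  | true  | true  = refl

  ○-→-○○→ : ∀ (φ : Form P) → ⊢ (○ φ →' ○ (○ φ →' φ))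
  ○-→-○○→ φ = MP (A0 taut) (●-mp (○ φ) φ)
    where
    taut : Tautology ((● (○ φ →' φ) ∧' ○ φ →' ● φ) →' (○ φ →' ○ (○ φ →' φ)))
    taut v with v (● (○ φ →' φ)) | v (● φ)
    ... | true  | true  = refl
    ... | true  | false = refl
    ... | false | true  = refl
    ... | false | false = refl

  [_]○-var : ∀ (ψ : Form P) (p : P) → ⊢ (ψ →' ○ (ψ →' var p)) → ⊢ [ ψ ] ○ var p
  [ ψ ]○-var p ⊢ψ→○ψ→p =
    ⊢-↔-elimʳ (AN ψ (● var p)) (⊢-taut₂ taut (A● ψ (var p)) ⊢ψ→○[ψ]p)
    where
    ⊢ψ→○[ψ]p : ⊢ (ψ →' ○ [ ψ ] var p)
    ⊢ψ→○[ψ]p = ⊢-→-↔-substʳ (REO (AP ψ p)) ⊢ψ→○ψ→p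

    taut : Tautology (([ ψ ] ● var p ↔' (ψ →' ● [ ψ ] var p))
                        →' (ψ →' ○ [ ψ ] var p) →' (ψ →' ¬' [ ψ ] ● var p))
    taut v with v ([ ψ ] ● var p) | eval v ψ | v (● [ ψ ] var p)
    ... | true  | true  | true  = refl
    ... | true  | true  | false = refl
    ... | true  | false | true  = refl
    ... | true  | false | false = refl
    ... | false | true  | true  = refl
    ... | false | true  | false = refl
    ... | false | false | true  = refl
    ... | false | false | false = refl

mainTheorem18 : {P : Set} (p : P) → ⊢ ([ ¬' ● var p ] ¬' ● var p)
mainTheorem18 p = [ ○ var p ]○-var p (○-→-○○→ (var p))
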